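{- If $N$ is a $\beta$-normal form and $\mathtt{Infer}(N)=(\Gamma,\sigma)$, then $\Gamma\in\mathcal{C}$ and $\sigma\in\mathcal{T}_{NF}$.
   Context: Terms (de Bruijn): $M,N::=\underline{n}\mid (M\,N)\mid\lambda.M$, $n\in\mathbb{N}^*$; application associates to the left. A $\beta$-normal form is a term with no subterm of the form $((\lambda.M)\,N)$; these are exactly $\underline{n}$, $\lambda.N'$ with $N'$ a $\beta$-normal form, and $\underline{n}\,N_1\cdots N_m$ with each $N_j$ a $\beta$-normal form. Types: $\mathcal{A}$ is a denumerable set of type variables; $\tau\in\mathcal{T}::=\alpha\mid u\to\tau$, $u\in\mathcal{U}::=\omega\mid u\wedge u\mid\tau$, with $\wedge$ commutative, associative, neutral element $\omega$; $\to$ associates to the right. Contexts: $\Gamma::=nil\mid u.\Gamma$; $\omega^{k}.\Gamma$ is $\Gamma$ prefixed by $k$ copies of $\omega$; $nil\wedge\Gamma=\Gamma\wedge nil=\Gamma$, $(u_1.\Gamma)\wedge(u_2.\Delta)=(u_1\wedge u_2).(\Gamma\wedge\Delta)$. Subsets: $\rho\in\mathcal{T}_C::=\alpha\mid\varphi\to\rho$ with $\varphi\in\mathcal{T}_{NF}$; $\varphi\in\mathcal{T}_{NF}::=\alpha\mid v\to\varphi$ with $v\in\mathcal{U}_C$; $v\in\mathcal{U}_C::=\omega\mid v\wedge v\mid\rho$ with $\rho\in\mathcal{T}_C$. $\mathcal{C}$ is the set of contexts all of whose elements lie in $\mathcal{U}_C$. The algorithm $\mathtt{Infer}$: $\mathtt{Infer}(\underline{n})=(\omega^{n-1}.\alpha.nil,\alpha)$,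 $\alpha$ fresh; $\mathtt{Infer}(\lambda.N')$: let $(\Gamma',\sigma)=\mathtt{Infer}(N')$; if $\Gamma'=u.\Gamma$ return $(\Gamma,u\to\sigma)$, else return $(nil,\omega\to\sigma)$; $\mathtt{Infer}(\underline{n}\,N_1\cdots N_m)$ ($m\ge1$): let $(\Gamma^i,\sigma_i)=\mathtt{Infer}(N_i)$ and $\alpha$ fresh; return $((\omega^{n-1}.(\sigma_1\to\cdots\to\sigma_m\to\alpha).nil)\wedge\Gamma^1\wedge\cdots\wedge\Gamma^m,\alpha)$. -}

module Defs where

open import Data.Nat using (ℕ; zero; suc)
open import Data.List using (List; []; _∷_; _++_; replicate)
open import Data.List.Relation.Unary.All using (All)
open import Data.Product using (_×_; _,_)
open import Data.Maybe using (Maybe; just; nothing)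
open import Data.Empty using (⊥)

-- Terms in de Bruijn notation.  var k denotes the index \underline{k+1}
-- (indices n ∈ ℕ* are represented as n = suc k).

data Term : Set where
  var : ℕ → Term
  app : Term → Term → Term
  lam : Term → Term

data _⊑_ : Term → Term → Set where
  here  : ∀ {M} → M ⊑ M
  appˡ  : ∀ {P M N} → P ⊑ M → P ⊑ app M N
  appʳ  : ∀ {P M N} → P ⊑ N → P ⊑ app M N
  lamᵇ  : ∀ {P M} → P ⊑ M → P ⊑ lam M

IsBetaNF : Term → Set
IsBetaNF M = ∀ P Q → app (lam P) Q ⊑ M → ⊥

-- Intersections
-- u ::= ω | u ∧ u | τ  are represented as finite multisets, i.e. lists
-- of types (ω = [], ∧ = ++, τ = τ ∷ []); the predicates below are
-- invariant under permutation, so commutativity is respected.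

data Ty : Set where
  tv  : ℕ → Ty
  _⇒_ : List Ty → Ty → Ty

infixr 5 _⇒_

U : Set
U = List Ty

ω : U
ω = []

_∧_ : U → U → U
_∧_ = _++_

Ctx : Set
Ctx = List U

ωs : ℕ → Ctx → Ctx
ωs k Γ = replicate k ω ++ Γ

_∧c_ : Ctx → Ctx → Ctx
[]       ∧c Δ        = Δ
(u ∷ Γ)  ∧c []       = u ∷ Γ
(u ∷ Γ)  ∧c (v ∷ Δ)  = (u ∧ v) ∷ (Γ ∧c Δ)

arrows : List Ty → Ty → Ty
arrows []       τ = τ
arrows (σ ∷ σs) τ = (σ ∷ []) ⇒ arrows σs τ

mutual
  data InTC : Ty → Set where
    tc-var : ∀ a → InTC (tv a)
    tc-arr : ∀ {φ ρ} → InTNF φ → InTC ρ → InTC ((φ ∷ []) ⇒ ρ)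

  data InTNF : Ty → Set where
    tnf-var : ∀ a → InTNF (tv a)
    tnf-arr : ∀ {v φ} → All InTC v → InTNF φ → InTNF (v ⇒ φ)

InUC : U → Set
InUC = All InTC

InC : Ctx → Set
InC = All InUC

-- The algorithm Infer.  A counter supplies fresh type variables: a call
-- with counter c only uses variables ≥ c and returns the next free one.

mutual
  infer : Term → ℕ → Ctx × Ty × ℕ
  infer (var k) c = ωs k ((tv c ∷ []) ∷ []) , tv c , suc c
  infer (lam M) c with infer M c
  ... | u ∷ Γ , σ , c' = Γ , u ⇒ σ , c'
  ... | []    , σ , c' = [] , ω ⇒ σ , c'
  infer (app M N) c with spine (app M N) c
  ... | just (k , σs , Γs , c') =
          (ωs k ((arrows σs (tv c') ∷ []) ∷ []) ∧c Γs) , tv c' , suc c'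
  -- head is a λ: a β-redex, outside the domain of Infer; arbitrary value
  ... | nothing = [] , tv c , suc c

  spine : Term → ℕ → Maybe (ℕ × List Ty × Ctx × ℕ)
  spine (var k)   c = just (k , [] , [] , c)
  spine (lam M)   c = nothing
  spine (app M N) c with spine M c
  ... | nothing = nothing
  ... | just (k , σs , Γs , c') with infer N c'
  ...   | Γ , σ , c'' = just (k , σs ++ (σ ∷ []) , Γs ∧c Γ , c'')

Infer : Term → ℕ → Ctx × Ty
Infer M c with infer M c
... | Γ , σ , _ = Γ , σ

-- Simultaneous induction on terms and on application spines: variables get a
-- type variable, λ moves a context entry of U_C to the left of an arrow, and a
-- spine x N₁ ⋯ Nₘ gives x the type σ₁ → ⋯ → σₘ → α, which lies in T_C because
-- each σᵢ lies in T_NF; contexts stay in C since ∧ and ω-padding preserve it.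
module Submission where

open import Defs
open import Data.Nat using (ℕ; zero; suc)
open import Data.Product using (_×_; _,_)
open import Data.List using (List; []; _∷_)
open import Data.Maybe using (just; nothing)
open import Data.List.Relation.Unary.All using (All; []; _∷_)
open import Data.List.Relation.Unary.All.Properties using (++⁺)
import Data.Maybe.Relation.Unary.All as Maybe
open import Relation.Binary.PropositionalEquality using (_≡_; refl)

InC-∧c : ∀ {Γ Δ} → InC Γ → InC Δ → InC (Γ ∧c Δ)
InC-∧c []       qs       = qs
InC-∧c (p ∷ ps) []       = p ∷ ps
InC-∧c (p ∷ ps) (q ∷ qs) = ++⁺ p q ∷ InC-∧c ps qs

InC-ωs : ∀ k {Γ} → InC Γ → InC (ωs k Γ)
InC-ωs zero    ps = ps
InC-ωs (suc k) ps = [] ∷ InC-ωs k ps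

InTC-arrows : ∀ {σs} a → All InTNF σs → InTC (arrows σs (tv a))
InTC-arrows a []       = tc-var a
InTC-arrows a (p ∷ ps) = tc-arr p (InTC-arrows a ps)

InC-singleton : ∀ k {τ} → InTC τ → InC (ωs k ((τ ∷ []) ∷ []))
InC-singleton k p = InC-ωs k ((p ∷ []) ∷ [])

Admissible : Ctx × Ty × ℕ → Set
Admissible (Γ , σ , _) = InC Γ × InTNF σ

AdmissibleSpine : ℕ × List Ty × Ctx × ℕ → Set
AdmissibleSpine (_ , σs , Γs , _) = All InTNF σs × InC Γs

mutual
  infer-admissible : ∀ M c → Admissible (infer M c)
  infer-admissible (var k) c = InC-singleton k (tc-var c) , tnf-var c
  infer-admissible (lam M) c with infer M c | infer-admissible M c
  ... | u ∷ Γ , σ , _ | pu ∷ pΓ , pσ = pΓ , tnf-arr pu pσ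
  ... | []    , σ , _ | _        , pσ = [] , tnf-arr [] pσ
  infer-admissible (app M N) c with spine (app M N) c | spine-admissible (app M N) c
  ... | just (k , σs , Γs , c') | Maybe.just (pσs , pΓs) =
        InC-∧c (InC-singleton k (InTC-arrows c' pσs)) pΓs , tnf-var c'
  ... | nothing | Maybe.nothing = [] , tnf-var c

  spine-admissible : ∀ M c → Maybe.All AdmissibleSpine (spine M c)
  spine-admissible (var k)   c = Maybe.just ([] , [])
  spine-admissible (lam M)   c = Maybe.nothing
  spine-admissible (app M N) c with spine M c | spine-admissible M c
  ... | nothing | Maybe.nothing = Maybe.nothing
  ... | just (k , σs , Γs , c') | Maybe.just (pσs , pΓs)
    with infer N c' | infer-admissible N c'
  ...   | Γ , σ , _ | pΓ , pσ = Maybe.just (++⁺ pσs (pσ ∷ []) , InC-∧c pΓs pΓ)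

lemma3p2 : (N : Term) → IsBetaNF N → (c : ℕ) → (Γ : Ctx) → (σ : Ty) →
    Infer N c ≡ (Γ , σ) → InC Γ × InTNF σ
lemma3p2 N _ c Γ σ eq with infer N c | infer-admissible N c
lemma3p2 N _ c Γ σ refl | _ , _ , _ | admissible = admissible
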